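{- Let $\beta(2)=\beta(3)=2$ and $\beta(c)=1$ for integers $c\ge4$. For every integer $c\ge2$, the sequence $\{M(c;r)\}_{r=\beta(c)}^\infty$ is strictly increasing. For every integer $r\ge1$, the sequence $\{M(c;r)\}_{c=1}^\infty$ is strictly increasing.
   Context: The necklace polynomial is $M(\alpha;n)=\frac1n\sum_{d\mid n}\mu(n/d)\alpha^d$ for integers $n\ge1$, where $\mu$ is the Möbius function. -}

module Defs where

open import Data.Nat as ℕ using (ℕ; zero; suc)
open import Data.Nat.Divisibility using (_∣?_)
open import Data.Integer as ℤ using (ℤ; +_; 0ℤ; 1ℤ)
open import Data.Rational as ℚ using (ℚ)
open import Data.List using (List; filter; map; foldr; upTo)
open import Relation.Nullary using (yes; no)

-- Möbius function μ, computed by trial division.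
-- mobiusAux fuel p n, where n has no prime factor < p:
--  * n = 1 gives 1 (empty product), n = 0 gives 0 (never used);
--  * if p ∣ n then p is the least prime factor of n: if p² ∣ n then
--    n is not squarefree and μ = 0; otherwise μ(n) = - μ(n / p);
--  * otherwise continue with p + 1.
-- The fuel n is always enough (each step increases p ≤ n or divides n).
mobiusAux : ℕ → ℕ → ℕ → ℤ
mobiusAux zero    p        n = 1ℤ
mobiusAux (suc f) p        0 = 0ℤ
mobiusAux (suc f) p        1 = 1ℤ
mobiusAux (suc f) zero     n = mobiusAux f 2 n
mobiusAux (suc f) (suc q)  n@(suc (suc _)) with suc q ∣? n
... | no  _ = mobiusAux f (suc (suc q)) n
... | yes _ with (suc q ℕ.* suc q) ∣? n
...   | yes _ = 0ℤ
...   | no  _ = ℤ.- mobiusAux f (suc q) (n ℕ./ suc q)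

μ : ℕ → ℤ
μ n = mobiusAux (ℕ.suc (ℕ.suc n) ℕ.* ℕ.suc (ℕ.suc n)) 2 n

sumℤ : List ℤ → ℤ
sumℤ = foldr ℤ._+_ 0ℤ

-- Necklace polynomial M(α; n) = (1/n) Σ_{d ∣ n} μ(n/d) α^d, for n ≥ 1,
-- evaluated at an integer α, as a rational number.  The sum ranges over
-- d = k + 1 for k < n with d ∣ n, i.e. over all positive divisors of n.
M : ℤ → (n : ℕ) → .{{_ : ℕ.NonZero n}} → ℚ
M α n = ℚ._/_ (sumℤ (map (λ k → μ (n ℕ./ suc k) ℤ.* (α ℤ.^ suc k))
                          (filter (λ k → suc k ∣? n) (upTo n)))) n

β : ℕ → ℕ
β 2 = 2
β 3 = 2
β _ = 1

{-# OPTIONS --safe #-}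
-- Write n M(c; n) = Σ_{d ∣ n} μ(n/d) c^d = c^n + E(c; n).  Proper divisors of n are at most n/2 and |μ| ≤ 1,
-- so |E(c; n)| ≤ Σ_{1 ≤ d ≤ n/2} c^d ≤ 2 c^⌊n/2⌋ for c ≥ 2: the top term dominates.  Comparing
-- (c^n + E(c; n)) (n + 1) with (c^(n+1) + E(c; n + 1)) n therefore reduces growth in n to an elementary
-- inequality between c, n and c^⌊n/2⌋, valid from n = 6, 3, 2 on for c = 2, 3, ≥ 4; the remaining
-- cases are evaluated.  For growth in c the numerators differ by Σ_{d ∣ n} μ(n/d) g(d) with
-- g(d) = (c + 1)^d − c^d, and since g at least doubles at each step, g(n) exceeds Σ_{d < n} g(d).
module Submission where

open import Defs
open import Data.Nat using (ℕ; suc; _≤_)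
open import Data.Integer using (+_)
open import Data.Rational using (_<_)
open import Data.Product using (_×_)

open import Level using (Level)
open import Data.Bool using (true; false)
open import Function using (_∘_)
open import Data.Product using (_,_; proj₁; proj₂)
open import Data.List using (List; []; _∷_; _++_; [_]; map; filter; upTo; applyUpTo)
open import Data.Nat.ListAction using (sum)
open import Data.Nat.ListAction.Properties using (sum-++)
open import Data.List.Properties
  using (filter-++; filter-accept; filter-reject; upTo-∷ʳ; applyUpTo-∷ʳ; map-++; map-cong; map-upTo; ++-identityʳ)
open import Data.Nat as ℕ using (zero; _+_; _*_; _^_; _∸_; ⌊_/2⌋; ⌈_/2⌉; _≤′_; z≤n; s≤s)
open import Data.Nat.Properties
open import Data.Nat.Divisibility using (_∣_; _∣?_; ∣-refl; quotient; quotient>1; m∣n⇒n≡quotient*m)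
open import Data.Nat.DivMod using (n/n≡1)
open import Data.Nat.Tactic.RingSolver using (solve-∀)
open import Data.Integer as ℤ using (ℤ; 0ℤ; -[1+_]; ∣_∣; _⊖_)
import Data.Integer.Properties as ℤₚ
open import Algebra.Properties.CommutativeSemigroup ℤₚ.+-commutativeSemigroup using (interchange)
import Data.Rational as ℚ
import Data.Rational.Properties as ℚₚ
open import Data.Rational.Unnormalised using (mkℚᵘ; *<*)
import Data.Rational.Unnormalised.Properties as ℚᵘₚ
open import Relation.Nullary using (¬_; yes; no; does)
open import Relation.Nullary.Decidable using (Dec; from-yes; _×-dec_)
open import Relation.Unary using (Pred; Decidable)
open import Relation.Binary.PropositionalEquality hiding ([_])

private
  variable
    a p : Level
    A : Set a

∣mobiusAux∣≤1 : ∀ fuel q n → ∣ mobiusAux fuel q n ∣ ≤ 1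
∣mobiusAux∣≤1 zero    q       n               = ≤-refl
∣mobiusAux∣≤1 (suc f) q       zero            = z≤n
∣mobiusAux∣≤1 (suc f) q       1               = ≤-refl
∣mobiusAux∣≤1 (suc f) zero    n@(suc (suc _)) = ∣mobiusAux∣≤1 f 2 n
∣mobiusAux∣≤1 (suc f) (suc q) n@(suc (suc _)) with suc q ∣? n
... | no  _ = ∣mobiusAux∣≤1 f (suc (suc q)) n
... | yes _ with suc q * suc q ∣? n
...   | yes _ = z≤n
...   | no  _ = ≤-trans (≤-reflexive (ℤₚ.∣-i∣≡∣i∣ (mobiusAux f (suc q) (n ℕ./ suc q))))
                          (∣mobiusAux∣≤1 f (suc q) (n ℕ./ suc q))

∣μ∣≤1 : ∀ n → ∣ μ n ∣ ≤ 1
∣μ∣≤1 n = ∣mobiusAux∣≤1 (suc (suc n) * suc (suc n)) 2 n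

sumℤ-++ : ∀ xs ys → sumℤ (xs ++ ys) ≡ sumℤ xs ℤ.+ sumℤ ys
sumℤ-++ []       ys = sym (ℤₚ.+-identityˡ (sumℤ ys))
sumℤ-++ (x ∷ xs) ys = trans (cong (ℤ._+_ x) (sumℤ-++ xs ys)) (sym (ℤₚ.+-assoc x (sumℤ xs) (sumℤ ys)))

sumℤ-map-+ : ∀ (f g : A → ℤ) xs →
             sumℤ (map (λ x → f x ℤ.+ g x) xs) ≡ sumℤ (map f xs) ℤ.+ sumℤ (map g xs)
sumℤ-map-+ f g []       = refl
sumℤ-map-+ f g (x ∷ xs) =
  trans (cong (ℤ._+_ (f x ℤ.+ g x)) (sumℤ-map-+ f g xs)) (interchange (f x) (g x) _ _)

∣sumℤ-map-filter∣≤ : ∀ {P : Pred A p} (P? : Decidable P) {f : A → ℤ} {g : A → ℕ} →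
                     (∀ x → ∣ f x ∣ ≤ g x) → ∀ xs → ∣ sumℤ (map f (filter P? xs)) ∣ ≤ sum (map g xs)
∣sumℤ-map-filter∣≤ P? f≤g []       = z≤n
∣sumℤ-map-filter∣≤ P? {f} {g} f≤g (x ∷ xs) with does (P? x)
... | false = ≤-trans (∣sumℤ-map-filter∣≤ P? f≤g xs) (m≤n+m _ (g x))
... | true  = ≤-trans (ℤₚ.∣i+j∣≤∣i∣+∣j∣ (f x) _)
                     (+-mono-≤ (f≤g x) (∣sumℤ-map-filter∣≤ P? f≤g xs))

sum-applyUpTo-suc : ∀ (g : ℕ → ℕ) n → sum (applyUpTo g (suc n)) ≡ sum (applyUpTo g n) + g n
sum-applyUpTo-suc g n = begin
  sum (applyUpTo g (suc n))           ≡⟨ cong sum (applyUpTo-∷ʳ g n) ⟨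
  sum (applyUpTo g n ++ [ g n ])      ≡⟨ sum-++ (applyUpTo g n) [ g n ] ⟩
  sum (applyUpTo g n) + (g n + 0)     ≡⟨ cong (_+_ (sum (applyUpTo g n))) (+-identityʳ (g n)) ⟩
  sum (applyUpTo g n) + g n           ∎
  where open ≡-Reasoning

Doubling : (ℕ → ℕ) → Set
Doubling g = ∀ k → g k + g k ≤ g (suc k)

sum-applyUpTo-doubling : ∀ {g} → Doubling g → ∀ n → g 0 + sum (applyUpTo g n) ≤ g n
sum-applyUpTo-doubling             doubling zero    = ≤-reflexive (+-identityʳ _)
sum-applyUpTo-doubling {g} doubling (suc n) = begin
  g 0 + sum (applyUpTo g (suc n))    ≡⟨ cong (_+_ (g 0)) (sum-applyUpTo-suc g n) ⟩
  g 0 + (sum (applyUpTo g n) + g n)  ≡⟨ +-assoc (g 0) (sum (applyUpTo g n)) (g n) ⟨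
  g 0 + sum (applyUpTo g n) + g n    ≤⟨ +-monoˡ-≤ (g n) (sum-applyUpTo-doubling doubling n) ⟩
  g n + g n                          ≤⟨ doubling n ⟩
  g (suc n)                          ∎
  where open ≤-Reasoning

^-doubling : ∀ {c} → 2 ≤ c → Doubling (c ^_)
^-doubling {c} 2≤c k = begin
  c ^ k + c ^ k        ≡⟨ cong (_+_ (c ^ k)) (+-identityʳ (c ^ k)) ⟨
  2 * c ^ k            ≤⟨ *-monoˡ-≤ (c ^ k) 2≤c ⟩
  c * c ^ k            ∎
  where open ≤-Reasoning

powerSum : ℕ → ℕ → ℕ
powerSum c n = sum (applyUpTo (λ d → c ^ suc d) n)

powerSum≤^+^ : ∀ {c} → 2 ≤ c → ∀ n → powerSum c n ≤ c ^ n + c ^ n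
powerSum≤^+^ {c} 2≤c n = begin
  powerSum c n                      ≤⟨ m≤n+m (powerSum c n) 1 ⟩
  sum (applyUpTo (c ^_) (suc n))    ≡⟨ sum-applyUpTo-suc (c ^_) n ⟩
  sum (applyUpTo (c ^_) n) + c ^ n  ≤⟨ +-monoˡ-≤ (c ^ n) sum<c^n ⟩
  c ^ n + c ^ n                     ∎
  where
  open ≤-Reasoning
  sum<c^n : sum (applyUpTo (c ^_) n) ≤ c ^ n
  sum<c^n = ≤-trans (m≤n+m _ 1) (sum-applyUpTo-doubling {c ^_} (^-doubling 2≤c) n)

powerGap : ℕ → ℕ → ℕ
powerGap c zero    = 0
powerGap c (suc d) = powerGap c d * suc c + c ^ d

suc^≡^+powerGap : ∀ c d → suc c ^ d ≡ c ^ d + powerGap c d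
suc^≡^+powerGap c zero    = refl
suc^≡^+powerGap c (suc d) = begin
  suc c * suc c ^ d                           ≡⟨ cong (suc c *_) (suc^≡^+powerGap c d) ⟩
  suc c * (c ^ d + powerGap c d)              ≡⟨ regroup c (c ^ d) (powerGap c d) ⟩
  c * c ^ d + (powerGap c d * suc c + c ^ d)  ∎
  where
  open ≡-Reasoning
  regroup : ∀ c x g → suc c * (x + g) ≡ c * x + (g * suc c + x)
  regroup = solve-∀

powerGap-doubling : ∀ {c} → 1 ≤ c → Doubling (powerGap c)
powerGap-doubling {c} 1≤c d = begin
  g + g              ≡⟨ cong (_+_ g) (+-identityʳ g) ⟨
  2 * g              ≡⟨ *-comm 2 g ⟩
  g * 2              ≤⟨ *-monoʳ-≤ g (s≤s 1≤c) ⟩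
  g * suc c          ≤⟨ m≤m+n (g * suc c) (c ^ d) ⟩
  g * suc c + c ^ d  ∎
  where
  open ≤-Reasoning
  g = powerGap c d

-- Index k stands for the divisor k + 1, as in the definition of M.
divisorIndices : ℕ → ℕ → List ℕ
divisorIndices n b = filter (λ k → suc k ∣? n) (upTo b)

divisorIndices-suc : ∀ n b →
                     divisorIndices n (suc b) ≡ divisorIndices n b ++ filter (λ k → suc k ∣? n) [ b ]
divisorIndices-suc n b = trans (cong (filter P?) (sym (upTo-∷ʳ b))) (filter-++ P? (upTo b) [ b ])
  where P? = λ k → suc k ∣? n

divisorIndices-suc-∣ : ∀ {n b} → suc b ∣ n → divisorIndices n (suc b) ≡ divisorIndices n b ++ [ b ]
divisorIndices-suc-∣ {n} {b} b+1∣n = trans (divisorIndices-suc n b)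
  (cong (_++_ (divisorIndices n b)) (filter-accept (λ k → suc k ∣? n) b+1∣n))

divisorIndices-suc-∤ : ∀ {n b} → ¬ suc b ∣ n → divisorIndices n (suc b) ≡ divisorIndices n b
divisorIndices-suc-∤ {n} {b} b+1∤n = trans (divisorIndices-suc n b)
  (trans (cong (_++_ (divisorIndices n b)) (filter-reject (λ k → suc k ∣? n) b+1∤n))
         (++-identityʳ (divisorIndices n b)))

divisorIndices-shrink : ∀ {n h b} → h ≤′ b → (∀ {k} → h ≤ k → k ℕ.< b → ¬ suc k ∣ n) →
                        divisorIndices n b ≡ divisorIndices n h
divisorIndices-shrink (ℕ.≤′-reflexive refl) _ = refl
divisorIndices-shrink {b = suc b} (ℕ.≤′-step h≤′b) no-divisor =
  trans (divisorIndices-suc-∤ (no-divisor (≤′⇒≤ h≤′b) (n<1+n b)))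
        (divisorIndices-shrink h≤′b (λ h≤k k<b → no-divisor h≤k (m<n⇒m<1+n k<b)))

∣∧<⇒≤⌊n/2⌋ : ∀ {d n} → d ∣ n → d ℕ.< n → d ≤ ⌊ n /2⌋
∣∧<⇒≤⌊n/2⌋ {d} {n} d∣n d<n = begin
  d            ≡⟨ n≡⌊n+n/2⌋ d ⟩
  ⌊ d + d /2⌋  ≤⟨ ⌊n/2⌋-mono d+d≤n ⟩
  ⌊ n /2⌋      ∎
  where
  open ≤-Reasoning
  d+d≤n : d + d ≤ n
  d+d≤n = begin
    d + d             ≡⟨ cong (_+_ d) (+-identityʳ d) ⟨
    2 * d             ≤⟨ *-monoˡ-≤ d (quotient>1 d∣n d<n) ⟩
    quotient d∣n * d  ≡⟨ m∣n⇒n≡quotient*m d∣n ⟨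
    n                 ∎

divisorIndices-proper : ∀ m → divisorIndices (suc m) m ≡ divisorIndices (suc m) ⌊ suc m /2⌋
divisorIndices-proper m = divisorIndices-shrink (≤⇒≤′ (≤-pred (⌊n/2⌋<n m))) no-divisor
  where
  no-divisor : ∀ {k} → ⌊ suc m /2⌋ ≤ k → k ℕ.< m → ¬ suc k ∣ suc m
  no-divisor h≤k k<m k+1∣ = <-irrefl refl (≤-trans (∣∧<⇒≤⌊n/2⌋ k+1∣ (s≤s k<m)) h≤k)

-- Möbius sums

-- möbiusSum w n b = Σ μ(n/d) w(d) over the divisors d ≤ b of n; thus M α n is necklaceSum α n / n by definition.
möbiusTerm : (ℕ → ℤ) → ℕ → ℕ → ℤ
möbiusTerm w n k = μ (n ℕ./ suc k) ℤ.* w (suc k)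

möbiusSum : (ℕ → ℤ) → ℕ → ℕ → ℤ
möbiusSum w n b = sumℤ (map (möbiusTerm w n) (divisorIndices n b))

necklaceSum : ℤ → ℕ → ℤ
necklaceSum α n = möbiusSum (α ℤ.^_) n n

möbiusSum-cong : ∀ {w v} → (∀ d → w d ≡ v d) → ∀ n b → möbiusSum w n b ≡ möbiusSum v n b
möbiusSum-cong w≗v n b =
  cong sumℤ (map-cong (λ k → cong (ℤ._*_ (μ (n ℕ./ suc k))) (w≗v (suc k))) (divisorIndices n b))

möbiusSum-+ : ∀ w v n b → möbiusSum (λ d → w d ℤ.+ v d) n b ≡ möbiusSum w n b ℤ.+ möbiusSum v n b
möbiusSum-+ w v n b = trans (cong sumℤ (map-cong distrib (divisorIndices n b)))
                            (sumℤ-map-+ (möbiusTerm w n) (möbiusTerm v n) (divisorIndices n b))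
  where
  distrib : ∀ k → möbiusTerm (λ d → w d ℤ.+ v d) n k ≡ möbiusTerm w n k ℤ.+ möbiusTerm v n k
  distrib k = ℤₚ.*-distribˡ-+ (μ (n ℕ./ suc k)) (w (suc k)) (v (suc k))

möbiusSum-top : ∀ w m → möbiusSum w (suc m) (suc m) ≡ w (suc m) ℤ.+ möbiusSum w (suc m) m
möbiusSum-top w m = begin
  sumℤ (map t (divisorIndices n n))
    ≡⟨ cong (sumℤ ∘ map t) (divisorIndices-suc-∣ {n} {m} ∣-refl) ⟩
  sumℤ (map t (divisorIndices n m ++ [ m ]))    ≡⟨ cong sumℤ (map-++ t (divisorIndices n m) [ m ]) ⟩
  sumℤ (map t (divisorIndices n m) ++ [ t m ])  ≡⟨ sumℤ-++ (map t (divisorIndices n m)) [ t m ] ⟩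
  möbiusSum w n m ℤ.+ (t m ℤ.+ 0ℤ)              ≡⟨ cong (ℤ._+_ (möbiusSum w n m)) (ℤₚ.+-identityʳ (t m)) ⟩
  möbiusSum w n m ℤ.+ t m                       ≡⟨ ℤₚ.+-comm (möbiusSum w n m) (t m) ⟩
  t m ℤ.+ möbiusSum w n m                       ≡⟨ cong (ℤ._+ möbiusSum w n m) t-top ⟩
  w n ℤ.+ möbiusSum w n m                       ∎
  where
  open ≡-Reasoning
  n = suc m
  t = möbiusTerm w n
  t-top : t m ≡ w n
  t-top = trans (cong (λ q → μ q ℤ.* w n) (n/n≡1 n)) (ℤₚ.*-identityˡ (w n))

möbiusSum-proper : ∀ w m → möbiusSum w (suc m) m ≡ möbiusSum w (suc m) ⌊ suc m /2⌋
möbiusSum-proper w m = cong (sumℤ ∘ map (möbiusTerm w (suc m))) (divisorIndices-proper m)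

∣möbiusSum∣≤ : ∀ {w g} → (∀ d → ∣ w d ∣ ≤ g d) → ∀ n b →
               ∣ möbiusSum w n b ∣ ≤ sum (applyUpTo (g ∘ suc) b)
∣möbiusSum∣≤ {w} {g} w≤g n b = begin
  ∣ möbiusSum w n b ∣           ≤⟨ ∣sumℤ-map-filter∣≤ (λ k → suc k ∣? n) term≤ (upTo b) ⟩
  sum (map (g ∘ suc) (upTo b))  ≡⟨ cong sum (map-upTo (g ∘ suc) b) ⟩
  sum (applyUpTo (g ∘ suc) b)   ∎
  where
  open ≤-Reasoning
  term≤ : ∀ k → ∣ möbiusTerm w n k ∣ ≤ g (suc k)
  term≤ k = begin
    ∣ μ (n ℕ./ suc k) ℤ.* w (suc k) ∣        ≡⟨ ℤₚ.abs-* (μ (n ℕ./ suc k)) (w (suc k)) ⟩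
    ∣ μ (n ℕ./ suc k) ∣ * ∣ w (suc k) ∣      ≤⟨ *-mono-≤ (∣μ∣≤1 (n ℕ./ suc k)) (w≤g (suc k)) ⟩
    1 * g (suc k)                            ≡⟨ *-identityˡ (g (suc k)) ⟩
    g (suc k)                                ∎

pos-^ : ∀ m n → + (m ^ n) ≡ (+ m) ℤ.^ n
pos-^ m zero    = refl
pos-^ m (suc n) = trans (ℤₚ.pos-* m (m ^ n)) (cong (ℤ._*_ (+ m)) (pos-^ m n))

∣i∣≤n⇒-n≤i≤n : ∀ {i n} → ∣ i ∣ ≤ n → ℤ.- (+ n) ℤ.≤ i × i ℤ.≤ + n
∣i∣≤n⇒-n≤i≤n {+ m}       m≤n       = ℤₚ.neg-≤-pos , ℤ.+≤+ m≤n
∣i∣≤n⇒-n≤i≤n { -[1+ m ]} (s≤s m≤n) = ℤ.-≤- m≤n , ℤ.-≤+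

+<+-∸ : ∀ {p q r} → p + r ℕ.< q → + p ℤ.< + q ℤ.- + r
+<+-∸ {p} {q} {r} p+r<q = begin-strict
  + p            <⟨ ℤ.+<+ (m+n≤o⇒m≤o∸n (suc p) p+r<q) ⟩
  + (q ∸ r)      ≡⟨ ℤₚ.⊖-≥ (≤-trans (m≤n+m r p) (<⇒≤ p+r<q)) ⟨
  q ⊖ r          ≡⟨ ℤₚ.m-n≡m⊖n q r ⟨
  + q ℤ.- + r    ∎
  where open ℤₚ.≤-Reasoning

perturbed-*-< : ∀ {x y : ℤ} {a b A B n₁ n₂ : ℕ} → ∣ x ∣ ≤ A → ∣ y ∣ ≤ B →
                (a + A) * n₁ + B * n₂ ℕ.< b * n₂ →
                (+ a ℤ.+ x) ℤ.* + n₁ ℤ.< (+ b ℤ.+ y) ℤ.* + n₂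
perturbed-*-< {x} {y} {a} {b} {A} {B} {n₁} {n₂} ∣x∣≤A ∣y∣≤B h = begin-strict
  (+ a ℤ.+ x) ℤ.* + n₁                     ≤⟨ ℤₚ.*-monoʳ-≤-nonNeg (+ n₁) (ℤₚ.+-monoʳ-≤ (+ a) x≤A) ⟩
  + (a + A) ℤ.* + n₁                       ≡⟨ ℤₚ.pos-* (a + A) n₁ ⟨
  + ((a + A) * n₁)                         <⟨ +<+-∸ h ⟩
  + (b * n₂) ℤ.- + (B * n₂)                ≡⟨ cong₂ ℤ._-_ (ℤₚ.pos-* b n₂) (ℤₚ.pos-* B n₂) ⟩
  + b ℤ.* + n₂ ℤ.- + B ℤ.* + n₂            ≡⟨ cong (ℤ._+_ (+ b ℤ.* + n₂)) (ℤₚ.neg-distribˡ-* (+ B) (+ n₂)) ⟩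
  + b ℤ.* + n₂ ℤ.+ (ℤ.- + B) ℤ.* + n₂      ≡⟨ ℤₚ.*-distribʳ-+ (+ n₂) (+ b) (ℤ.- + B) ⟨
  (+ b ℤ.- + B) ℤ.* + n₂                   ≤⟨ ℤₚ.*-monoʳ-≤-nonNeg (+ n₂) (ℤₚ.+-monoʳ-≤ (+ b) -B≤y) ⟩
  (+ b ℤ.+ y) ℤ.* + n₂                     ∎
  where
  open ℤₚ.≤-Reasoning
  x≤A = proj₂ (∣i∣≤n⇒-n≤i≤n {x} ∣x∣≤A)
  -B≤y = proj₁ (∣i∣≤n⇒-n≤i≤n {y} ∣y∣≤B)

-- ℚ._/_ normalises mkℚᵘ p q, and _<_ on unnormalised fractions is cross-multiplication.
/-<-cross : ∀ {p r : ℤ} {q s : ℕ} → p ℤ.* + suc s ℤ.< r ℤ.* + suc q → p ℚ./ suc q < r ℚ./ suc s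
/-<-cross {p} {r} {q} {s} h = ℚₚ.toℚᵘ-cancel-<
  (ℚᵘₚ.<-respˡ-≃ (ℚᵘₚ.≃-sym (ℚₚ.toℚᵘ-fromℚᵘ (mkℚᵘ p q)))
    (ℚᵘₚ.<-respʳ-≃ (ℚᵘₚ.≃-sym (ℚₚ.toℚᵘ-fromℚᵘ (mkℚᵘ r s))) (*<* h)))

-- Growth in r

necklaceSum≡power+proper : ∀ c m →
  necklaceSum (+ c) (suc m) ≡ + (c ^ suc m) ℤ.+ möbiusSum ((+ c) ℤ.^_) (suc m) ⌊ suc m /2⌋
necklaceSum≡power+proper c m = trans (möbiusSum-top ((+ c) ℤ.^_) m)
  (cong₂ ℤ._+_ (sym (pos-^ c (suc m))) (möbiusSum-proper ((+ c) ℤ.^_) m))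

∣möbiusSum-power∣≤powerSum : ∀ c n b → ∣ möbiusSum ((+ c) ℤ.^_) n b ∣ ≤ powerSum c b
∣möbiusSum-power∣≤powerSum c =
  ∣möbiusSum∣≤ {(+ c) ℤ.^_} {c ^_} (λ d → ≤-reflexive (cong ∣_∣ (sym (pos-^ c d))))

-- M(c; n) < M(c; n + 1) cross-multiplied, with both error terms E(c; _) at their worst.
GrowthCondition : ℕ → ℕ → Set
GrowthCondition c n =
  (c ^ n + powerSum c ⌊ n /2⌋) * suc n + powerSum c ⌊ suc n /2⌋ * n ℕ.< c ^ suc n * n

growth⇒M-increasing : ∀ c m → GrowthCondition c (suc m) → M (+ c) (suc m) < M (+ c) (suc (suc m))
growth⇒M-increasing c m growth = /-<-cross {S (suc m)} {S (suc (suc m))} {m} {suc m}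
  (subst₂ (λ s t → s ℤ.* + suc (suc m) ℤ.< t ℤ.* + suc m)
    (sym (necklaceSum≡power+proper c m)) (sym (necklaceSum≡power+proper c (suc m))) perturbed)
  where
  S = necklaceSum (+ c)
  E : ℕ → ℤ
  E n = möbiusSum ((+ c) ℤ.^_) n ⌊ n /2⌋
  perturbed : (+ (c ^ suc m) ℤ.+ E (suc m)) ℤ.* + suc (suc m)
              ℤ.< (+ (c ^ suc (suc m)) ℤ.+ E (suc (suc m))) ℤ.* + suc m
  perturbed = perturbed-*-< {E (suc m)} {E (suc (suc m))} {c ^ suc m} {c ^ suc (suc m)}
    (∣möbiusSum-power∣≤powerSum c (suc m) ⌊ suc m /2⌋)
    (∣möbiusSum-power∣≤powerSum c (suc (suc m)) ⌊ suc (suc m) /2⌋)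
    growth

-- At n = 1 the estimate powerSum c ⌊ n /2⌋ ≤ 2 c ^ ⌊ n /2⌋ behind reducedGrowth⇒growth is too weak for c = 4.
growth-1 : ∀ {c} → 4 ≤ c → GrowthCondition c 1
growth-1 {c} 4≤c = begin-strict
  (c * 1 + 0) * 2 + (c * 1 + 0) * 1  ≡⟨ regroup c ⟩
  3 * c                              <⟨ m<n+m (3 * c) (≤-trans (s≤s z≤n) 4≤c) ⟩
  c + 3 * c                          ≤⟨ *-monoˡ-≤ c 4≤c ⟩
  c * c                              ≡⟨ regroup′ c ⟩
  c * (c * 1) * 1                    ∎
  where
  open ≤-Reasoning
  regroup : ∀ c → (c * 1 + 0) * 2 + (c * 1 + 0) * 1 ≡ 3 * c
  regroup = solve-∀
  regroup′ : ∀ c → c * c ≡ c * (c * 1) * 1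
  regroup′ = solve-∀

-- GrowthCondition (e + 1) n after bounding both power sums by 2 (e + 1)^⌈n/2⌉ and dividing by (e + 1)^⌈n/2⌉;
-- Y stands for (e + 1)^⌊n/2⌋.
ReducedGrowth : ℕ → ℕ → ℕ → Set
ReducedGrowth e n Y = Y + 4 * n + 2 ℕ.< e * Y * n

reducedGrowth⇒growth : ∀ e n → ReducedGrowth e n (suc e ^ ⌊ n /2⌋) → GrowthCondition (suc e) n
reducedGrowth⇒growth zero      n ()
reducedGrowth⇒growth e@(suc _) n reduced = begin-strict
  (c ^ n + powerSum c ⌊ n /2⌋) * suc n + powerSum c ⌈ n /2⌉ * n
    ≤⟨ +-mono-≤ (*-monoˡ-≤ (suc n) (+-mono-≤ (≤-reflexive split) B≤2X)) (*-monoˡ-≤ n B′≤2X) ⟩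
  (Y * X + (X + X)) * suc n + (X + X) * n
    ≡⟨ regroup X Y n ⟩
  X * (Y * n + (Y + 4 * n + 2))
    <⟨ *-monoʳ-< X {{m^n≢0 c ⌈ n /2⌉}} (+-monoʳ-< (Y * n) reduced) ⟩
  X * (Y * n + e * Y * n)
    ≡⟨ regroup′ e X Y n ⟩
  c * (Y * X) * n
    ≡⟨ cong (λ t → c * t * n) split ⟨
  c ^ suc n * n
    ∎
  where
  open ≤-Reasoning
  c = suc e
  Y = c ^ ⌊ n /2⌋
  X = c ^ ⌈ n /2⌉
  split : c ^ n ≡ Y * X
  split = trans (cong (c ^_) (sym (⌊n/2⌋+⌈n/2⌉≡n n))) (^-distribˡ-+-* c ⌊ n /2⌋ ⌈ n /2⌉)
  B′≤2X : powerSum c ⌈ n /2⌉ ≤ X + X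
  B′≤2X = powerSum≤^+^ (s≤s (s≤s z≤n)) ⌈ n /2⌉
  B≤2X : powerSum c ⌊ n /2⌋ ≤ X + X
  B≤2X = ≤-trans (powerSum≤^+^ (s≤s (s≤s z≤n)) ⌊ n /2⌋) (+-mono-≤ Y≤X Y≤X)
    where Y≤X = ^-monoʳ-≤ c (⌊n/2⌋≤⌈n/2⌉ n)
  regroup : ∀ X Y n → (Y * X + (X + X)) * suc n + (X + X) * n ≡ X * (Y * n + (Y + 4 * n + 2))
  regroup = solve-∀
  regroup′ : ∀ e X Y n → X * (Y * n + e * Y * n) ≡ suc e * (Y * X) * n
  regroup′ = solve-∀

reducedGrowth-mono : ∀ {e e′ n n′ Y Y′} → e ≤ e′ → n ≤ n′ → Y ≤ Y′ → 1 ≤ e * n → 4 ≤ e * Y →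
                     ReducedGrowth e n Y → ReducedGrowth e′ n′ Y′
reducedGrowth-mono {e} {e′} {n} {n′} {Y} {Y′} e≤e′ n≤n′ Y≤Y′ 1≤en 4≤eY base
  with m≤n⇒∃[o]m+o≡n n≤n′ | m≤n⇒∃[o]m+o≡n Y≤Y′
... | i , refl | j , refl = begin-strict
  (Y + j) + 4 * (n + i) + 2                        ≡⟨ regroup Y j n i ⟩
  (Y + 4 * n + 2) + (j + 4 * i)                    <⟨ +-monoˡ-< (j + 4 * i) base ⟩
  e * Y * n + (j + 4 * i)                          ≤⟨ +-monoʳ-≤ (e * Y * n) (+-mono-≤ j≤enj 4i≤eYi) ⟩
  e * Y * n + (e * n * j + e * Y * i)              ≤⟨ m≤m+n _ (e * j * i) ⟩
  e * Y * n + (e * n * j + e * Y * i) + e * j * i  ≡⟨ regroup′ e Y j n i ⟩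
  e * (Y + j) * (n + i)                            ≤⟨ *-monoˡ-≤ (n + i) (*-monoˡ-≤ (Y + j) e≤e′) ⟩
  e′ * (Y + j) * (n + i)                           ∎
  where
  open ≤-Reasoning
  j≤enj : j ≤ e * n * j
  j≤enj = m≤n*m j (e * n) {{ℕ.>-nonZero 1≤en}}
  4i≤eYi : 4 * i ≤ e * Y * i
  4i≤eYi = *-monoˡ-≤ i 4≤eY
  regroup : ∀ Y j n i → (Y + j) + 4 * (n + i) + 2 ≡ (Y + 4 * n + 2) + (j + 4 * i)
  regroup = solve-∀
  regroup′ : ∀ e Y j n i →
             e * Y * n + (e * n * j + e * Y * i) + e * j * i ≡ e * (Y + j) * (n + i)
  regroup′ = solve-∀

ReducedGrowthBase : ℕ → ℕ → Set
ReducedGrowthBase e n = 1 ≤ e * n × 4 ≤ e * suc e ^ ⌊ n /2⌋ × ReducedGrowth e n (suc e ^ ⌊ n /2⌋)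

reducedGrowthBase? : ∀ e n → Dec (ReducedGrowthBase e n)
reducedGrowthBase? e n = (1 ℕ.≤? e * n) ×-dec (4 ℕ.≤? e * suc e ^ ⌊ n /2⌋) ×-dec (_ ℕ.<? _)

M-increasing-beyond : ∀ {e₀ n₀ e m} → e₀ ≤ e → n₀ ≤ suc m → ReducedGrowthBase e₀ n₀ →
                      M (+ suc e) (suc m) < M (+ suc e) (suc (suc m))
M-increasing-beyond {e₀} {n₀} {e} {m} e₀≤e n₀≤n (1≤e₀n₀ , 4≤e₀Y₀ , base) =
  growth⇒M-increasing (suc e) m (reducedGrowth⇒growth e (suc m)
    (reducedGrowth-mono e₀≤e n₀≤n Y₀≤Y 1≤e₀n₀ 4≤e₀Y₀ base))
  where
  Y₀≤Y : suc e₀ ^ ⌊ n₀ /2⌋ ≤ suc e ^ ⌊ suc m /2⌋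
  Y₀≤Y = ≤-trans (^-monoˡ-≤ ⌊ n₀ /2⌋ (s≤s e₀≤e)) (^-monoʳ-≤ (suc e) (⌊n/2⌋-mono n₀≤n))

M-increasing-in-r : (c : ℕ) → 2 ≤ c → (k : ℕ) → β c ≤ suc k →
                    M (+ c) (suc k) < M (+ c) (suc (suc k))
M-increasing-in-r 0 () _ _
M-increasing-in-r 1 (s≤s ()) _ _
M-increasing-in-r 2 _ 0 (s≤s ())
M-increasing-in-r 2 _ 1 _ = from-yes (M (+ 2) 2 ℚₚ.<? M (+ 2) 3)
M-increasing-in-r 2 _ 2 _ = from-yes (M (+ 2) 3 ℚₚ.<? M (+ 2) 4)
M-increasing-in-r 2 _ 3 _ = from-yes (M (+ 2) 4 ℚₚ.<? M (+ 2) 5)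
M-increasing-in-r 2 _ 4 _ = from-yes (M (+ 2) 5 ℚₚ.<? M (+ 2) 6)
M-increasing-in-r 2 _ (suc (suc (suc (suc (suc b))))) _ =
  M-increasing-beyond ≤-refl (m≤m+n 6 b) (from-yes (reducedGrowthBase? 1 6))
M-increasing-in-r 3 _ 0 (s≤s ())
M-increasing-in-r 3 _ 1 _ = from-yes (M (+ 3) 2 ℚₚ.<? M (+ 3) 3)
M-increasing-in-r 3 _ (suc (suc b)) _ =
  M-increasing-beyond ≤-refl (m≤m+n 3 b) (from-yes (reducedGrowthBase? 2 3))
M-increasing-in-r (suc (suc (suc (suc a)))) _ 0 _ =
  growth⇒M-increasing (4 + a) 0 (growth-1 (m≤m+n 4 a))
M-increasing-in-r (suc (suc (suc (suc a)))) _ (suc b) _ =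
  M-increasing-beyond (m≤m+n 3 a) (m≤m+n 2 b) (from-yes (reducedGrowthBase? 3 2))

-- Growth in c

necklaceSum-suc : ∀ c n →
                  necklaceSum (+ suc c) n ≡ necklaceSum (+ c) n ℤ.+ möbiusSum (λ d → + powerGap c d) n n
necklaceSum-suc c n =
  trans (möbiusSum-cong pow-split n n) (möbiusSum-+ ((+ c) ℤ.^_) (λ d → + powerGap c d) n n)
  where
  pow-split : ∀ d → (+ suc c) ℤ.^ d ≡ (+ c) ℤ.^ d ℤ.+ + powerGap c d
  pow-split d = begin
    (+ suc c) ℤ.^ d                  ≡⟨ pos-^ (suc c) d ⟨
    + (suc c ^ d)                    ≡⟨ cong +_ (suc^≡^+powerGap c d) ⟩
    + (c ^ d + powerGap c d)         ≡⟨ ℤₚ.pos-+ (c ^ d) (powerGap c d) ⟩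
    + (c ^ d) ℤ.+ + powerGap c d     ≡⟨ cong (ℤ._+ + powerGap c d) (pos-^ c d) ⟩
    (+ c) ℤ.^ d ℤ.+ + powerGap c d   ∎
    where open ≡-Reasoning

möbiusSum-powerGap>0 : ∀ {c} → 1 ≤ c → ∀ m → 0ℤ ℤ.< möbiusSum (λ d → + powerGap c d) (suc m) (suc m)
möbiusSum-powerGap>0 {c} 1≤c m = begin-strict
  0ℤ                                   <⟨ +<+-∸ proper<top ⟩
  + powerGap c (suc m) ℤ.- + S         ≤⟨ ℤₚ.+-monoʳ-≤ (+ powerGap c (suc m)) -S≤E ⟩
  + powerGap c (suc m) ℤ.+ E           ≡⟨ möbiusSum-top w m ⟨
  möbiusSum w (suc m) (suc m)          ∎
  where
  open ℤₚ.≤-Reasoning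
  w = λ d → + powerGap c d
  E = möbiusSum w (suc m) m
  S = sum (applyUpTo (powerGap c ∘ suc) m)
  -S≤E : ℤ.- + S ℤ.≤ E
  -S≤E = proj₁ (∣i∣≤n⇒-n≤i≤n {E} (∣möbiusSum∣≤ {w} {powerGap c} (λ _ → ≤-refl) (suc m) m))
  proper<top : S ℕ.< powerGap c (suc m)
  proper<top = sum-applyUpTo-doubling {powerGap c ∘ suc} (powerGap-doubling 1≤c ∘ suc) m

M-increasing-in-c : (k : ℕ) → (c : ℕ) → 1 ≤ c → M (+ c) (suc k) < M (+ suc c) (suc k)
M-increasing-in-c k c 1≤c = /-<-cross {S c} {S (suc c)} {k} {k} (ℤₚ.*-monoʳ-<-pos (+ suc k) S<S)
  where
  open ℤₚ.≤-Reasoning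
  S = λ α → necklaceSum (+ α) (suc k)
  S<S : S c ℤ.< S (suc c)
  S<S = begin-strict
    S c                                                         ≡⟨ ℤₚ.+-identityʳ (S c) ⟨
    S c ℤ.+ 0ℤ                                                  <⟨ ℤₚ.+-monoʳ-< (S c) (möbiusSum-powerGap>0 1≤c k) ⟩
    S c ℤ.+ möbiusSum (λ d → + powerGap c d) (suc k) (suc k)    ≡⟨ necklaceSum-suc c (suc k) ⟨
    S (suc c)                                                   ∎

proposition1 :
    ((c : ℕ) → 2 ≤ c → (k : ℕ) → β c ≤ suc k →
       M (+ c) (suc k) < M (+ c) (suc (suc k)))
    ×
    ((k : ℕ) → (c : ℕ) → 1 ≤ c →
       M (+ c) (suc k) < M (+ suc c) (suc k))
proposition1 = M-increasing-in-r , M-increasing-in-c
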